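{- Let $q = p^r$ with $q \equiv 1 \pmod 4$, let $\ell \neq p$ be a prime, and let $k \in (\mathbf{Z}/\ell)^\times$. If $\alpha, \beta \colon \mathbf{F}_q^{\boxtimes} \to \mathbf{Z}/\ell$ are voltage assignments satisfying $\theta^\alpha_{a,k} = \theta^\beta_{a,k}$ for all $a \in \mathbf{F}_q$, then $\alpha = \beta$.
   Context: $\mathbf{F}_q^{\boxtimes}$ is the set of nonzero squares in $\mathbf{F}_q$. A voltage assignment is a function $\alpha \colon \mathbf{F}_q^{\boxtimes} \to \mathbf{Z}/\ell$, not identically zero, with $\alpha(-s) = -\alpha(s)$ for all $s$. Let $\zeta_p = e^{2\pi i/p}$, $\zeta_\ell = e^{2\pi i/\ell}$, and $\mathrm{tr}\colon \mathbf{F}_q \to \mathbf{F}_p$ the trace $x \mapsto x + x^p + \dots + x^{p^{r-1}}$. For $a \in \mathbf{F}_q$, $k \in \mathbf{Z}/\ell$, define $\theta^\alpha_{a,k} = \sum_{s \in \mathbf{F}_q^{\boxtimes}} \zeta_p^{\mathrm{tr}(as)} \zeta_\ell^{k\alpha(s)}$. -}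

module Defs where

open import Level using (Level; _⊔_)
open import Algebra.Bundles using (CommutativeRing)
open import Data.Nat as ℕ using (ℕ; zero; suc)
open import Data.Fin as Fin using (Fin; toℕ)
open import Data.Bool using (Bool; true; false; _∧_; not; T)
open import Data.List using (List; []; _∷_; map; filter; foldr; length; upTo)
open import Data.Bool.ListAction using (any)
open import Data.List.Relation.Unary.Any using (Any)
open import Data.List.Relation.Unary.AllPairs using (AllPairs)
open import Data.Product using (∃; _×_)
open import Relation.Nullary using (¬_; Dec; does)
open import Relation.Binary.PropositionalEquality using (_≡_)
open import Data.Nat.Divisibility using (_∣_)

private variable c r : Level

record IsFieldCR (R : CommutativeRing c r) : Set (c ⊔ r) where
  open CommutativeRing R
  field
    1≉0     : ¬ (1# ≈ 0#)
    inverse : ∀ x → ¬ (x ≈ 0#) → ∃ λ y → x * y ≈ 1#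

module _ (R : CommutativeRing c r) where
  open CommutativeRing R

  ofℕ : ℕ → Carrier
  ofℕ zero    = 0#
  ofℕ (suc n) = 1# + ofℕ n

  pow : Carrier → ℕ → Carrier
  pow x zero    = 1#
  pow x (suc n) = x * pow x n

  sumR : List Carrier → Carrier
  sumR = foldr _+_ 0#

record FiniteField (p r : ℕ) c ℓ : Set (Level.suc (c ⊔ ℓ)) where
  field
    cring     : CommutativeRing c ℓ
  open CommutativeRing cring
  field
    isField  : IsFieldCR cring
    _≟_      : ∀ x y → Dec (x ≈ y)
    elems    : List Carrier
    complete : ∀ x → Any (x ≈_) elems
    distinct : AllPairs (λ x y → ¬ (x ≈ y)) elems
    card     : length elems ≡ p ℕ.^ r


  tr : Carrier → Carrier
  tr x = sumR cring (map (λ i → pow cring x (p ℕ.^ i)) (upTo r))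

  isNzSq : Carrier → Bool
  isNzSq s = not (does (s ≟ 0#)) ∧ any (λ t → does ((t * t) ≟ s)) elems

  squares : List Carrier
  squares = filter (λ s → isNzSq s Data.Bool.≟ true) elems

-- A field K of characteristic 0 containing a primitive p-th root of unity ζp
-- and a primitive ℓ-th root of unity ζℓ (p, ℓ prime); e.g. K = ℂ,
-- ζp = e^{2πi/p}, ζℓ = e^{2πi/ℓ}.
record CyclotomicField (p ℓ : ℕ) c r : Set (Level.suc (c ⊔ r)) where
  field
    cring    : CommutativeRing c r
  open CommutativeRing cring
  field
    isField : IsFieldCR cring
    char0   : ∀ n → ofℕ cring n ≈ 0# → n ≡ 0
    ζp      : Carrier
    ζp^p    : pow cring ζp p ≈ 1#
    ζp≠1    : ¬ (ζp ≈ 1#)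
    ζℓ      : Carrier
    ζℓ^ℓ    : pow cring ζℓ ℓ ≈ 1#
    ζℓ≠1    : ¬ (ζℓ ≈ 1#)

module _ {p r ℓ : ℕ} {c₁ r₁ c₂ r₂ : Level}
         (F : FiniteField p r c₁ r₁) (K : CyclotomicField p ℓ c₂ r₂) where
  private
    module F where
      open FiniteField F public
      open CommutativeRing cring public
    module K where
      open CyclotomicField K public
      open CommutativeRing cring public

  -- additive character: ζp ^ tr(x), where tr(x) = n · 1 with n ∈ {0,…,p-1}
  ψ : F.Carrier → K.Carrier
  ψ x = sumR K.cring (map (λ n → if′ does (ofℕ F.cring n F.≟ F.tr x) then pow K.cring K.ζp n) (upTo p))
    where
      if′_then_ : Bool → K.Carrier → K.Carrier
      if′ true  then y = y
      if′ false then y = K.0#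

  θ : (α : F.Carrier → Fin ℓ) (a : F.Carrier) (k : Fin ℓ) → K.Carrier
  θ α a k = sumR K.cring (map (λ s → ψ (a F.* s) K.* pow K.cring K.ζℓ (toℕ k ℕ.* toℕ (α s))) F.squares)

-- α : F_q^⊠ → Z/ℓ is a voltage assignment (α is given on all of F_q, only its
-- values on nonzero squares matter; it must respect the setoid equality of F_q).
record IsVoltage {p r ℓ c₁ r₁} (F : FiniteField p r c₁ r₁) (α : CommutativeRing.Carrier (FiniteField.cring F) → Fin ℓ)
       : Set (c₁ ⊔ r₁) where
  open FiniteField F
  open CommutativeRing cring
  field
    resp    : ∀ {x y} → x ≈ y → α x ≡ α y
    odd     : ∀ s → T (isNzSq s) → ℓ ∣ (toℕ (α (- s)) ℕ.+ toℕ (α s))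
    nonzero : ∃ λ s → T (isNzSq s) × ¬ (toℕ (α s) ≡ 0)

{-# OPTIONS --safe #-}
-- θ^α_{a,k} = Σ_s ψ(a s) w_α(s) is the Fourier transform of the weight w_α(s) = [s ∈ F_q^⊠] ζℓ^{k α(s)}
-- for the additive character ψ(x) = ζp^{tr x}. Orthogonality of a nontrivial additive character gives
-- Fourier inversion Σ_a ψ(−a t) θ^α_{a,k} = q w_α(t), so equal θ's give equal weights (q ≠ 0 in
-- characteristic 0), and ζℓ^{k α(s)} = ζℓ^{k β(s)} forces α(s) = β(s) because ζℓ^k is again a
-- primitive ℓ-th root of unity. Most of the work is showing that ψ is a nontrivial character: tr is
-- additive because Frobenius is; tr(x)^p = tr(x) because x^q = x, so tr(x) is one of the p roots
-- 0, 1, …, p − 1 of X^p − X; and tr is not identically zero, being a monic polynomial of degree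
-- p^(r−1) < q.
module Submission where

open import Defs
open import Level using (Level)
open import Algebra.Bundles using (Monoid; CommutativeMonoid; CommutativeRing)
open import Data.Nat as ℕ using (ℕ; zero; suc; _<_; _≤_; _^_; _%_; _/_; NonZero)
import Data.Nat.Properties as ℕ
open import Data.Nat.Combinatorics using (_C_; nCk+nC[k+1]≡[n+1]C[k+1]; nC1≡n; nCn≡1)
open import Data.Nat.Divisibility using (_∣_; divides; ∣⇒≤)
open import Data.Nat.Coprimality using (prime⇒coprime; coprime-Bézout)
open import Data.Nat.DivMod using (m≡m%n+[m/n]*n; m%n<n)
open import Data.Nat.GCD using (module Bézout)
open import Data.Nat.Primality using (Prime; euclidsLemma; prime⇒nonZero; prime⇒nonTrivial)
open import Data.Fin using (Fin; toℕ; fromℕ)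
open import Data.Fin.Properties using (toℕ-fromℕ; toℕ-injective; toℕ<n)
open import Data.Vec.Functional using (Vector)
open import Data.Sum using (inj₁; inj₂)
open import Data.Vec as Vec using (Vec; []; _∷_; replicate; zipWith)
open import Data.Bool as Bool using (Bool; true; false; if_then_else_; not; _∧_; T)
open import Data.Bool.ListAction using (or)
open import Data.Empty using (⊥-elim)
open import Data.List using (List; []; _∷_; _∷ʳ_; map; length; applyUpTo; upTo; filter)
open import Data.List.Membership.Propositional.Properties using (∈-upTo⁺; ∈-upTo⁻)
open import Data.List.Relation.Unary.Unique.Propositional.Properties using (upTo⁺)
open import Data.List.Properties using (length-applyUpTo; map-upTo; upTo-∷ʳ; map-cong)
open import Data.List.Relation.Unary.All as All using (All; []; _∷_; all?)
import Data.List.Relation.Unary.All.Properties as Allₚ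
open import Data.List.Relation.Unary.All.Properties.Core using (All¬⇒¬Any; ¬Any⇒All¬; ¬All⇒Any¬)
open import Data.List.Relation.Unary.AllPairs using ([]; _∷_)
import Data.List.Relation.Unary.AllPairs.Properties as AllPairsₚ
open import Data.List.Relation.Unary.Any using (here; there; any?; satisfied)
import Data.List.Relation.Unary.Any.Properties as Anyₚ
open import Data.Product using (_×_; _,_; ∃; uncurry; proj₁; proj₂)
open import Function.Base using (_∘_; id)
open import Function.Bundles using (mk⇔)
open import Function.Definitions using (Inverseᵇ)
open import Relation.Binary.Bundles using (DecSetoid)
open import Relation.Binary.Core using (_Preserves_⟶_)
open import Relation.Binary.PropositionalEquality as ≡ using (_≡_)
open import Relation.Nullary using (¬_; Dec; yes; no; does)
open import Relation.Nullary.Decidable using (does-⇔)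

module ListSum {c ℓ} (M : CommutativeMonoid c ℓ) where
  open CommutativeMonoid M
  open import Algebra.Properties.CommutativeSemigroup commutativeSemigroup using (interchange)
  open import Data.List.Membership.Propositional using (_∈_)

  private variable
    a b : Level
    A : Set a
    B : Set b

  ∑ : List A → (A → Carrier) → Carrier
  ∑ []       f = ε
  ∑ (x ∷ xs) f = f x ∙ ∑ xs f

  ∑-cong : ∀ xs {f g : A → Carrier} → (∀ x → f x ≈ g x) → ∑ xs f ≈ ∑ xs g
  ∑-cong []       f≈g = refl
  ∑-cong (x ∷ xs) f≈g = ∙-cong (f≈g x) (∑-cong xs f≈g)

  ∑-cong-∈ : ∀ xs {f g : A → Carrier} → (∀ {x} → x ∈ xs → f x ≈ g x) → ∑ xs f ≈ ∑ xs g
  ∑-cong-∈ []       f≈g = refl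
  ∑-cong-∈ (x ∷ xs) f≈g = ∙-cong (f≈g (here ≡.refl)) (∑-cong-∈ xs (f≈g ∘ there))

  ∑-ε : ∀ xs → ∑ xs (λ (_ : A) → ε) ≈ ε
  ∑-ε []       = refl
  ∑-ε (x ∷ xs) = trans (identityˡ _) (∑-ε xs)

  ∑-distrib-∙ : ∀ xs (f g : A → Carrier) → ∑ xs (λ x → f x ∙ g x) ≈ ∑ xs f ∙ ∑ xs g
  ∑-distrib-∙ []       f g = sym (identityˡ ε)
  ∑-distrib-∙ (x ∷ xs) f g = trans (∙-congˡ (∑-distrib-∙ xs f g)) (interchange _ _ _ _)

  ∑-∷ʳ : ∀ xs y (f : A → Carrier) → ∑ (xs ∷ʳ y) f ≈ ∑ xs f ∙ f y
  ∑-∷ʳ []       y f = trans (identityʳ _) (sym (identityˡ _))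
  ∑-∷ʳ (x ∷ xs) y f = trans (∙-congˡ (∑-∷ʳ xs y f)) (sym (assoc _ _ _))

  ∑-map : ∀ (g : B → A) xs (f : A → Carrier) → ∑ (map g xs) f ≡ ∑ xs (f ∘ g)
  ∑-map g []       f = ≡.refl
  ∑-map g (x ∷ xs) f = ≡.cong (f (g x) ∙_) (∑-map g xs f)

  ∑-filter : ∀ (b : A → Bool) xs f →
             ∑ (filter (λ x → b x Bool.≟ true) xs) f ≈ ∑ xs (λ x → if b x then f x else ε)
  ∑-filter b []       f = refl
  ∑-filter b (x ∷ xs) f with b x
  ... | true  = ∙-congˡ (∑-filter b xs f)
  ... | false = trans (∑-filter b xs f) (sym (identityˡ _))

  ∑-comm : ∀ xs ys (f : A → B → Carrier) →
           ∑ xs (λ x → ∑ ys (f x)) ≈ ∑ ys (λ y → ∑ xs (λ x → f x y))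
  ∑-comm []       ys f = sym (∑-ε ys)
  ∑-comm (x ∷ xs) ys f = trans (∙-congˡ (∑-comm xs ys f)) (sym (∑-distrib-∙ ys (f x) _))

module KroneckerSum {c ℓ a e} (M : CommutativeMonoid c ℓ) (D : DecSetoid a e) where
  open CommutativeMonoid M
  open ListSum M
  open DecSetoid D using (_≟_)
    renaming (Carrier to A; _≈_ to _≃_; setoid to A-setoid; sym to ≃-sym; trans to ≃-trans)
  open import Data.List.Membership.Setoid A-setoid using (_∈_)
  open import Data.List.Relation.Unary.Unique.Setoid A-setoid using (Unique)

  δ : A → A → Carrier → Carrier
  δ x y v = if does (x ≟ y) then v else ε

  δ-≃ : ∀ {x y} v → x ≃ y → δ x y v ≈ v
  δ-≃ {x} {y} v x≃y with x ≟ y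
  ... | yes _   = refl
  ... | no  x≄y = ⊥-elim (x≄y x≃y)

  δ-≄ : ∀ {x y} v → ¬ x ≃ y → δ x y v ≈ ε
  δ-≄ {x} {y} v x≄y with x ≟ y
  ... | yes x≃y = ⊥-elim (x≄y x≃y)
  ... | no  _   = refl

  δ-cong : ∀ {x y x′ y′} v → (x ≃ y → x′ ≃ y′) → (x′ ≃ y′ → x ≃ y) → δ x y v ≈ δ x′ y′ v
  δ-cong {x} {y} {x′} {y′} v to from with x ≟ y | x′ ≟ y′
  ... | yes _   | yes _    = refl
  ... | no _    | no _     = refl
  ... | yes x≃y | no x′≄y′ = ⊥-elim (x′≄y′ (to x≃y))
  ... | no x≄y  | yes x′≃y′ = ⊥-elim (x≄y (from x′≃y′))

  δ-congᵛ : ∀ {x y v w} → (x ≃ y → v ≈ w) → δ x y v ≈ δ x y w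
  δ-congᵛ {x} {y} v≈w with x ≟ y
  ... | yes x≃y = v≈w x≃y
  ... | no _    = refl

  ∑-δ-∉ : ∀ {xs t} v → All (λ x → ¬ x ≃ t) xs → ∑ xs (λ x → δ x t v) ≈ ε
  ∑-δ-∉ v []                          = refl
  ∑-δ-∉ {x ∷ xs} {t} v (x≄t ∷ xs≄t) with x ≟ t
  ... | yes x≃t = ⊥-elim (x≄t x≃t)
  ... | no _    = trans (identityˡ _) (∑-δ-∉ v xs≄t)

  ∑-δ : ∀ {xs t} v → Unique xs → t ∈ xs → ∑ xs (λ x → δ x t v) ≈ v
  ∑-δ {x ∷ xs} {t} v (x≄xs ∷ unique) t∈ with x ≟ t | t∈
  ... | yes x≃t | here _     =
    trans (∙-congˡ (∑-δ-∉ v (All.map (λ x≄y y≃t → x≄y (≃-trans x≃t (≃-sym y≃t))) x≄xs))) (identityʳ v)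
  ... | yes x≃t | there t∈xs =
    ⊥-elim (All¬⇒¬Any (All.map (λ x≄y t≃y → x≄y (≃-trans x≃t t≃y)) x≄xs) t∈xs)
  ... | no x≄t  | here t≃x  = ⊥-elim (x≄t (≃-sym t≃x))
  ... | no _    | there t∈xs = trans (identityˡ _) (∑-δ v unique t∈xs)

  ∑-reindex : ∀ {xs} → Unique xs → (∀ x → x ∈ xs) → ∀ {σ τ} → Inverseᵇ _≃_ _≃_ σ τ →
              ∀ {h} → h Preserves _≃_ ⟶ _≈_ → ∑ xs (h ∘ σ) ≈ ∑ xs h
  ∑-reindex {xs} unique complete {σ} {τ} (invˡ , invʳ) {h} h-cong = begin
    ∑ xs (λ a → h (σ a))                         ≈⟨ ∑-cong xs (λ a → sym (∑-δ-at (σ a))) ⟩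
    ∑ xs (λ a → ∑ xs (λ b → δ b (σ a) (h b)))     ≈⟨ ∑-comm xs xs _ ⟩
    ∑ xs (λ b → ∑ xs (λ a → δ b (σ a) (h b)))     ≈⟨ ∑-cong xs (λ b → ∑-cong xs (λ a → swap a b)) ⟩
    ∑ xs (λ b → ∑ xs (λ a → δ a (τ b) (h b)))     ≈⟨ ∑-cong xs (λ b → ∑-δ (h b) unique (complete _)) ⟩
    ∑ xs h                                       ∎
    where
    open import Relation.Binary.Reasoning.Setoid setoid
    ∑-δ-at : ∀ t → ∑ xs (λ b → δ b t (h b)) ≈ h t
    ∑-δ-at t = trans (∑-cong xs (λ b → δ-congᵛ h-cong)) (∑-δ (h t) unique (complete t))
    swap : ∀ a b → δ b (σ a) (h b) ≈ δ a (τ b) (h b)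
    swap a b = δ-cong (h b) (λ b≃σa → ≃-sym (invʳ b≃σa)) (λ a≃τb → ≃-sym (invˡ a≃τb))

record IsNatIdeal {a} (P : ℕ → Set a) : Set a where
  field
    *-closed : ∀ k {m} → P m → P (k ℕ.* m)
    ∸-closed : ∀ {m n} → P (m ℕ.+ n) → P n → P m

  below-prime⇒≡0 : ∀ {p m} → Prime p → P p → ¬ P 1 → P m → m < p → m ≡ 0
  below-prime⇒≡0 {m = zero}    _       _  _   _  _   = ≡.refl
  -- By Bézout, 1 is a difference of multiples of p and m.
  below-prime⇒≡0 {m = suc _} prime-p Pp ¬P1 Pm m<p with coprime-Bézout (prime⇒coprime prime-p m<p)
  ... | Bézout.+- x y eq = ⊥-elim (¬P1 (∸-closed (≡.subst P (≡.sym eq) (*-closed x Pp)) (*-closed y Pm)))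
  ... | Bézout.-+ x y eq = ⊥-elim (¬P1 (∸-closed (≡.subst P (≡.sym eq) (*-closed y Pm)) (*-closed x Pp)))

module NatHomomorphism {c ℓ} (M : Monoid c ℓ) (h : ℕ → Monoid.Carrier M)
  (h-0 : Monoid._≈_ M (h 0) (Monoid.ε M))
  (h-+ : ∀ m n → Monoid._≈_ M (h (m ℕ.+ n)) (Monoid._∙_ M (h m) (h n))) where
  open Monoid M
  open import Relation.Binary.Reasoning.Setoid setoid

  h-* : ∀ k {m} → h m ≈ ε → h (k ℕ.* m) ≈ ε
  h-* zero    _     = h-0
  h-* (suc k) {m} hm≈ε = trans (h-+ m (k ℕ.* m)) (trans (∙-cong hm≈ε (h-* k hm≈ε)) (identityˡ ε))

  ker-isNatIdeal : IsNatIdeal (λ n → h n ≈ ε)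
  ker-isNatIdeal = record
    { *-closed = h-*
    ; ∸-closed = λ {m} {n} hm+n≈ε hn≈ε → begin
        h m             ≈⟨ identityʳ (h m) ⟨
        h m ∙ ε         ≈⟨ ∙-congˡ hn≈ε ⟨
        h m ∙ h n       ≈⟨ h-+ m n ⟨
        h (m ℕ.+ n)     ≈⟨ hm+n≈ε ⟩
        ε               ∎
    }

  h-% : ∀ {p} .{{_ : NonZero p}} → h p ≈ ε → ∀ m → h (m % p) ≈ h m
  h-% {p} hp≈ε m = begin
    h (m % p)                       ≈⟨ identityʳ _ ⟨
    h (m % p) ∙ ε                   ≈⟨ ∙-congˡ (h-* (m / p) hp≈ε) ⟨
    h (m % p) ∙ h (m / p ℕ.* p)     ≈⟨ h-+ (m % p) (m / p ℕ.* p) ⟨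
    h (m % p ℕ.+ m / p ℕ.* p)       ≡⟨ ≡.cong h (m≡m%n+[m/n]*n m p) ⟨
    h m                             ∎

  module _ {p} (prime-p : Prime p) (hp≈ε : h p ≈ ε) (h1≉ε : ¬ h 1 ≈ ε)
           (h-cancelˡ : ∀ m {x y} → h m ∙ x ≈ h m ∙ y → x ≈ y) where

    ker-below-prime : ∀ {m} → h m ≈ ε → m < p → m ≡ 0
    ker-below-prime hm≈ε = IsNatIdeal.below-prime⇒≡0 ker-isNatIdeal prime-p hp≈ε h1≉ε hm≈ε

    private
      injective-≤ : ∀ {m n} → m ≤ n → n < p → h m ≈ h n → m ≡ n
      injective-≤ {m} {n} m≤n n<p hm≈hn = ℕ.≤-antisym m≤n (ℕ.m∸n≡0⇒m≤n n∸m≡0)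
        where
        h[n∸m]≈ε : h (n ℕ.∸ m) ≈ ε
        h[n∸m]≈ε = h-cancelˡ m (begin
          h m ∙ h (n ℕ.∸ m)     ≈⟨ h-+ m (n ℕ.∸ m) ⟨
          h (m ℕ.+ (n ℕ.∸ m))   ≡⟨ ≡.cong h (ℕ.m+[n∸m]≡n m≤n) ⟩
          h n                   ≈⟨ hm≈hn ⟨
          h m                   ≈⟨ identityʳ (h m) ⟨
          h m ∙ ε               ∎)
        n∸m≡0 : n ℕ.∸ m ≡ 0
        n∸m≡0 = ker-below-prime h[n∸m]≈ε (ℕ.≤-<-trans (ℕ.m∸n≤m n m) n<p)

    h-injective : ∀ {m n} → m < p → n < p → h m ≈ h n → m ≡ n
    h-injective {m} {n} m<p n<p hm≈hn with ℕ.≤-total m n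
    ... | inj₁ m≤n = injective-≤ m≤n n<p hm≈hn
    ... | inj₂ n≤m = ≡.sym (injective-≤ n≤m m<p (sym hm≈hn))

[1+k]*[1+n]C[1+k]≡[1+n]*nCk : ∀ n k → suc k ℕ.* (suc n C suc k) ≡ suc n ℕ.* (n C k)
[1+k]*[1+n]C[1+k]≡[1+n]*nCk zero    zero    = ≡.refl
[1+k]*[1+n]C[1+k]≡[1+n]*nCk zero    (suc k) = ℕ.*-zeroʳ (2 ℕ.+ k)
[1+k]*[1+n]C[1+k]≡[1+n]*nCk (suc n) zero    =
  ≡.trans (ℕ.+-identityʳ _) (≡.trans (nC1≡n (2 ℕ.+ n)) (≡.sym (ℕ.*-identityʳ _)))
[1+k]*[1+n]C[1+k]≡[1+n]*nCk (suc n) (suc k) = begin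
  suc (suc k) ℕ.* (suc (suc n) C suc (suc k))  ≡⟨ ≡.cong (suc (suc k) ℕ.*_) (nCk+nC[k+1]≡[n+1]C[k+1] (suc n) (suc k)) ⟨
  suc (suc k) ℕ.* (a ℕ.+ b)                    ≡⟨ ℕ.*-distribˡ-+ (suc (suc k)) a b ⟩
  (a ℕ.+ suc k ℕ.* a) ℕ.+ suc (suc k) ℕ.* b    ≡⟨ ≡.cong₂ (λ u v → (a ℕ.+ u) ℕ.+ v) IH₀ IH₁ ⟩
  (a ℕ.+ suc n ℕ.* c₀) ℕ.+ suc n ℕ.* c₁        ≡⟨ ℕ.+-assoc a _ _ ⟩
  a ℕ.+ (suc n ℕ.* c₀ ℕ.+ suc n ℕ.* c₁)        ≡⟨ ≡.cong (a ℕ.+_) (ℕ.*-distribˡ-+ (suc n) c₀ c₁) ⟨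
  a ℕ.+ suc n ℕ.* (c₀ ℕ.+ c₁)                  ≡⟨ ≡.cong (λ u → a ℕ.+ suc n ℕ.* u) (nCk+nC[k+1]≡[n+1]C[k+1] n k) ⟩
  suc (suc n) ℕ.* a                            ∎
  where
  open ≡.≡-Reasoning
  a b c₀ c₁ : ℕ
  a  = suc n C suc k
  b  = suc n C suc (suc k)
  c₀ = n C k
  c₁ = n C suc k
  IH₀ : suc k ℕ.* a ≡ suc n ℕ.* c₀
  IH₀ = [1+k]*[1+n]C[1+k]≡[1+n]*nCk n k
  IH₁ : suc (suc k) ℕ.* b ≡ suc n ℕ.* c₁
  IH₁ = [1+k]*[1+n]C[1+k]≡[1+n]*nCk n (suc k)

prime∣pCk : ∀ {p k} → Prime p → 0 < k → k < p → p ∣ p C k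
prime∣pCk {suc n} {suc k} prime-p _ k<p
  with euclidsLemma (suc k) (suc n C suc k) prime-p
         (divides (n C k) (≡.trans ([1+k]*[1+n]C[1+k]≡[1+n]*nCk n k) (ℕ.*-comm (suc n) (n C k))))
... | inj₁ p∣k = ⊥-elim (ℕ.<⇒≱ k<p (∣⇒≤ p∣k))
... | inj₂ p∣C = p∣C

module RingLemmas {c ℓ} (R : CommutativeRing c ℓ) where
  open CommutativeRing R
  open import Relation.Binary.Reasoning.Setoid setoid
  open import Algebra.Properties.Semiring.Exp semiring using (^-congˡ; ^-homo-*; ^-assocʳ) renaming (_^_ to _^ᴿ_)
  open import Algebra.Properties.Semiring.Mult semiring using (×-homo-+; ×1-homo-*) renaming (_×_ to _·_)
  open import Algebra.Properties.AbelianGroup +-abelianGroup public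
    using (x∙y⁻¹≈ε⇒x≈y; x≈y⇒x∙y⁻¹≈ε)
    renaming (∙-cancelˡ to +-cancelˡ; identityʳ-unique to +-identityʳ-unique)
  open ListSum +-commutativeMonoid public
  open ListSum *-commutativeMonoid public using ()
    renaming (∑ to ∏; ∑-cong to ∏-cong; ∑-distrib-∙ to ∏-distrib-*)

  pow≡^ : ∀ x n → pow R x n ≡ x ^ᴿ n
  pow≡^ x zero    = ≡.refl
  pow≡^ x (suc n) = ≡.cong (x *_) (pow≡^ x n)

  ofℕ≡·1# : ∀ n → ofℕ R n ≡ n · 1#
  ofℕ≡·1# zero    = ≡.refl
  ofℕ≡·1# (suc n) = ≡.cong (1# +_) (ofℕ≡·1# n)

  pow-cong : ∀ n {x y} → x ≈ y → pow R x n ≈ pow R y n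
  pow-cong n {x} {y} x≈y rewrite pow≡^ x n | pow≡^ y n = ^-congˡ n x≈y

  pow-+ : ∀ x m n → pow R x (m ℕ.+ n) ≈ pow R x m * pow R x n
  pow-+ x m n rewrite pow≡^ x (m ℕ.+ n) | pow≡^ x m | pow≡^ x n = ^-homo-* x m n

  pow-* : ∀ x m n → pow R x (m ℕ.* n) ≈ pow R (pow R x m) n
  pow-* x m n rewrite pow≡^ x (m ℕ.* n) | pow≡^ (pow R x m) n | pow≡^ x m = sym (^-assocʳ x m n)

  pow-1# : ∀ n → pow R 1# n ≈ 1#
  pow-1# zero    = refl
  pow-1# (suc n) = trans (*-identityˡ _) (pow-1# n)

  pow-0# : ∀ n .{{_ : NonZero n}} → pow R 0# n ≈ 0#
  pow-0# (suc n) = zeroˡ _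

  ofℕ-+ : ∀ m n → ofℕ R (m ℕ.+ n) ≈ ofℕ R m + ofℕ R n
  ofℕ-+ m n rewrite ofℕ≡·1# (m ℕ.+ n) | ofℕ≡·1# m | ofℕ≡·1# n = ×-homo-+ 1# m n

  ofℕ-* : ∀ m n → ofℕ R (m ℕ.* n) ≈ ofℕ R m * ofℕ R n
  ofℕ-* m n rewrite ofℕ≡·1# (m ℕ.* n) | ofℕ≡·1# m | ofℕ≡·1# n = ×1-homo-* m n

  ofℕ-^ : ∀ m n → ofℕ R (m ℕ.^ n) ≈ pow R (ofℕ R m) n
  ofℕ-^ m zero    = +-identityʳ 1#
  ofℕ-^ m (suc n) = trans (ofℕ-* m (m ℕ.^ n)) (*-congˡ (ofℕ-^ m n))

  sumR-map : ∀ {a} {A : Set a} (f : A → Carrier) xs → sumR R (map f xs) ≡ ∑ xs f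
  sumR-map f []       = ≡.refl
  sumR-map f (x ∷ xs) = ≡.cong (f x +_) (sumR-map f xs)

  ∑-1# : ∀ {a} {A : Set a} (xs : List A) → ∑ xs (λ _ → 1#) ≈ ofℕ R (length xs)
  ∑-1# []       = refl
  ∑-1# (x ∷ xs) = +-congˡ (∑-1# xs)

  ∑-*ˡ : ∀ {a} {A : Set a} xs y (f : A → Carrier) → ∑ xs (λ x → y * f x) ≈ y * ∑ xs f
  ∑-*ˡ []       y f = sym (zeroʳ y)
  ∑-*ˡ (x ∷ xs) y f = trans (+-congˡ (∑-*ˡ xs y f)) (sym (distribˡ y _ _))

  ∑-*ʳ : ∀ {a} {A : Set a} xs y (f : A → Carrier) → ∑ xs (λ x → f x * y) ≈ ∑ xs f * y
  ∑-*ʳ xs y f = trans (∑-cong xs (λ x → *-comm (f x) y)) (trans (∑-*ˡ xs y f) (*-comm y _))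

  ∏-*ˡ : ∀ {a} {A : Set a} xs y (f : A → Carrier) → ∏ xs (λ x → y * f x) ≈ pow R y (length xs) * ∏ xs f
  ∏-*ˡ []       y f = sym (*-identityˡ 1#)
  ∏-*ˡ (x ∷ xs) y f = trans (*-congˡ (∏-*ˡ xs y f)) (interchange y (f x) _ _)
    where open import Algebra.Properties.CommutativeSemigroup *-commutativeSemigroup using (interchange)

  ∑-upTo-rotate : ∀ n (g : ℕ → Carrier) → g n ≈ g 0 → ∑ (upTo n) (g ∘ suc) ≈ ∑ (upTo n) g
  ∑-upTo-rotate n g gn≈g0 = +-cancelˡ (g 0) _ _ (begin
    g 0 + ∑ (upTo n) (g ∘ suc)       ≡⟨ ≡.cong (g 0 +_) (∑-map suc (upTo n) g) ⟨
    g 0 + ∑ (map suc (upTo n)) g     ≡⟨ ≡.cong (λ xs → g 0 + ∑ xs g) (map-upTo suc n) ⟩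
    ∑ (upTo (suc n)) g               ≡⟨ ≡.cong (λ xs → ∑ xs g) (upTo-∷ʳ n) ⟨
    ∑ (upTo n ∷ʳ n) g                ≈⟨ ∑-∷ʳ (upTo n) n g ⟩
    ∑ (upTo n) g + g n               ≈⟨ +-comm _ _ ⟩
    g n + ∑ (upTo n) g               ≈⟨ +-congʳ gn≈g0 ⟩
    g 0 + ∑ (upTo n) g               ∎)

module FieldLemmas {c ℓ} (R : CommutativeRing c ℓ) (isField : IsFieldCR R) where
  open CommutativeRing R
  open IsFieldCR isField
  open RingLemmas R
  open import Relation.Binary.Reasoning.Setoid setoid
  open import Algebra.Properties.Ring ring using (x[y-z]≈xy-xz)

  no-zero-divisors : ∀ {x y} → ¬ x ≈ 0# → x * y ≈ 0# → y ≈ 0#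
  no-zero-divisors {x} {y} x≉0 xy≈0 with inverse x x≉0
  ... | x⁻¹ , xx⁻¹≈1 = begin
    y                ≈⟨ *-identityˡ y ⟨
    1# * y           ≈⟨ *-congʳ (trans (*-comm x⁻¹ x) xx⁻¹≈1) ⟨
    (x⁻¹ * x) * y    ≈⟨ *-assoc x⁻¹ x y ⟩
    x⁻¹ * (x * y)    ≈⟨ *-congˡ xy≈0 ⟩
    x⁻¹ * 0#         ≈⟨ zeroʳ x⁻¹ ⟩
    0#               ∎

  *-≉0 : ∀ {x y} → ¬ x ≈ 0# → ¬ y ≈ 0# → ¬ x * y ≈ 0#
  *-≉0 x≉0 y≉0 xy≈0 = y≉0 (no-zero-divisors x≉0 xy≈0)

  *-cancelˡ : ∀ {x y z} → ¬ x ≈ 0# → x * y ≈ x * z → y ≈ z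
  *-cancelˡ {x} {y} {z} x≉0 xy≈xz =
    x∙y⁻¹≈ε⇒x≈y y z (no-zero-divisors x≉0 (trans (x[y-z]≈xy-xz x y z) (x≈y⇒x∙y⁻¹≈ε xy≈xz)))

  *-cancelʳ : ∀ {x y z} → ¬ z ≈ 0# → x * z ≈ y * z → x ≈ y
  *-cancelʳ z≉0 xz≈yz = *-cancelˡ z≉0 (trans (*-comm _ _) (trans xz≈yz (*-comm _ _)))

  x*y≈x⇒x≈0 : ∀ {x y} → ¬ y ≈ 1# → x * y ≈ x → x ≈ 0#
  x*y≈x⇒x≈0 {x} {y} y≉1 xy≈x = no-zero-divisors (λ y-1≈0 → y≉1 (x∙y⁻¹≈ε⇒x≈y y 1# y-1≈0))
    (trans (*-comm _ x) (trans (x[y-z]≈xy-xz x y 1#) (x≈y⇒x∙y⁻¹≈ε (trans xy≈x (sym (*-identityʳ x))))))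

  pow-≉0 : ∀ n {x} → ¬ x ≈ 0# → ¬ pow R x n ≈ 0#
  pow-≉0 zero    x≉0 = 1≉0
  pow-≉0 (suc n) x≉0 = *-≉0 x≉0 (pow-≉0 n x≉0)

  ∏-≉0 : ∀ {a} {A : Set a} xs {f : A → Carrier} → (∀ x → ¬ f x ≈ 0#) → ¬ ∏ xs f ≈ 0#
  ∏-≉0 []       f≉0 = 1≉0
  ∏-≉0 (x ∷ xs) f≉0 = *-≉0 (f≉0 x) (∏-≉0 xs f≉0)

module Polynomials {c ℓ} (R : CommutativeRing c ℓ) (isField : IsFieldCR R) where
  open CommutativeRing R
  open IsFieldCR isField using (1≉0)
  open RingLemmas R
  open FieldLemmas R isField
  open import Relation.Binary.Reasoning.Setoid setoid
  open import Algebra.Properties.Ring ring using (-‿distribʳ-*)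
  open import Algebra.Properties.AbelianGroup +-abelianGroup using (⁻¹-∙-comm; ε⁻¹≈ε; //-rightDividesˡ)
  open import Algebra.Properties.CommutativeSemigroup *-commutativeSemigroup using (x∙yz≈y∙xz)
  open import Algebra.Properties.CommutativeSemigroup +-commutativeSemigroup using (interchange)
  open import Data.List.Relation.Unary.Unique.Setoid setoid using (Unique)
  open import Data.List.Membership.Propositional using (_∈_)

  -- Coefficient vectors in Horner order: eval (c₀ ∷ c₁ ∷ …) x = c₀ + x (c₁ + x (…));
  -- evalMonic adds a leading coefficient 1.
  eval : ∀ {d} → Vec Carrier d → Carrier → Carrier
  eval []       x = 0#
  eval (c ∷ cs) x = c + x * eval cs x

  evalMonic : ∀ {d} → Vec Carrier d → Carrier → Carrier
  evalMonic []       x = 1#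
  evalMonic (c ∷ cs) x = c + x * evalMonic cs x

  evalMonic≈eval+pow : ∀ {d} (cs : Vec Carrier d) x → evalMonic cs x ≈ eval cs x + pow R x d
  evalMonic≈eval+pow []                x = sym (+-identityˡ 1#)
  evalMonic≈eval+pow {suc d} (c ∷ cs) x = begin
    c + x * evalMonic cs x               ≈⟨ +-congˡ (*-congˡ (evalMonic≈eval+pow cs x)) ⟩
    c + x * (eval cs x + pow R x d)      ≈⟨ +-congˡ (distribˡ x _ _) ⟩
    c + (x * eval cs x + pow R x (suc d)) ≈⟨ +-assoc _ _ _ ⟨
    c + x * eval cs x + pow R x (suc d)  ∎

  -- Horner's synthetic division by x - a.
  divide : ∀ {d} → Carrier → Vec Carrier (suc d) → Vec Carrier d
  divide a (c ∷ [])      = []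
  divide a (c ∷ c′ ∷ cs) = evalMonic (c′ ∷ cs) a ∷ divide a (c′ ∷ cs)

  horner-step : ∀ x a c e w → c + x * (e + (x - a) * w) ≈ (c + a * e) + (x - a) * (e + x * w)
  horner-step x a c e w = begin
    c + x * (e + x-a * w)                 ≈⟨ +-congˡ (distribˡ x e (x-a * w)) ⟩
    c + (x * e + x * (x-a * w))           ≈⟨ +-congˡ (+-cong xe≈ae+[x-a]e (x∙yz≈y∙xz x x-a w)) ⟩
    c + ((a * e + x-a * e) + x-a * (x * w)) ≈⟨ +-congˡ (+-assoc _ _ _) ⟩
    c + (a * e + (x-a * e + x-a * (x * w))) ≈⟨ +-assoc _ _ _ ⟨
    (c + a * e) + (x-a * e + x-a * (x * w)) ≈⟨ +-congˡ (distribˡ x-a e (x * w)) ⟨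
    (c + a * e) + x-a * (e + x * w)       ∎
    where
    x-a : Carrier
    x-a = x - a
    x≈a+[x-a] : x ≈ a + x-a
    x≈a+[x-a] = sym (trans (+-comm a x-a) (//-rightDividesˡ a x))
    xe≈ae+[x-a]e : x * e ≈ a * e + x-a * e
    xe≈ae+[x-a]e = trans (*-congʳ x≈a+[x-a]) (distribʳ e a x-a)

  evalMonic-divide : ∀ {d} a (cs : Vec Carrier (suc d)) x →
                     evalMonic cs x ≈ evalMonic cs a + (x - a) * evalMonic (divide a cs) x
  evalMonic-divide a (c ∷ []) x = begin
    c + x * 1#                         ≈⟨ +-congˡ (*-congˡ 1#≈1#+[x-a]0#) ⟩
    c + x * (1# + (x - a) * 0#)        ≈⟨ horner-step x a c 1# 0# ⟩
    (c + a * 1#) + (x - a) * (1# + x * 0#) ≈⟨ +-congˡ (*-congˡ (trans (+-congˡ (zeroʳ x)) (+-identityʳ 1#))) ⟩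
    (c + a * 1#) + (x - a) * 1#        ∎
    where
    1#≈1#+[x-a]0# : 1# ≈ 1# + (x - a) * 0#
    1#≈1#+[x-a]0# = sym (trans (+-congˡ (zeroʳ _)) (+-identityʳ 1#))
  evalMonic-divide a (c ∷ c′ ∷ cs) x =
    trans (+-congˡ (*-congˡ (evalMonic-divide a (c′ ∷ cs) x))) (horner-step x a c _ _)

  roots-bound : ∀ {d} (cs : Vec Carrier d) {xs} → Unique xs → All (λ x → evalMonic cs x ≈ 0#) xs →
                length xs ≤ d
  roots-bound cs        {[]}     _                   _                 = ℕ.z≤n
  roots-bound []        {x ∷ xs} _                   (root ∷ _)        = ⊥-elim (1≉0 root)
  roots-bound (c ∷ cs)  {a ∷ xs} (a≉xs ∷ unique)     (root-a ∷ roots)  =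
    ℕ.s≤s (roots-bound (divide a (c ∷ cs)) unique (All.zipWith (uncurry quotient-root) (a≉xs , roots)))
    where
    quotient-root : ∀ {y} → ¬ a ≈ y → evalMonic (c ∷ cs) y ≈ 0# → evalMonic (divide a (c ∷ cs)) y ≈ 0#
    quotient-root {y} a≉y root-y = no-zero-divisors (λ y-a≈0 → a≉y (sym (x∙y⁻¹≈ε⇒x≈y y a y-a≈0))) (begin
      (y - a) * evalMonic (divide a (c ∷ cs)) y                     ≈⟨ +-identityˡ _ ⟨
      0# + (y - a) * evalMonic (divide a (c ∷ cs)) y                ≈⟨ +-congʳ root-a ⟨
      evalMonic (c ∷ cs) a + (y - a) * evalMonic (divide a (c ∷ cs)) y ≈⟨ evalMonic-divide a (c ∷ cs) y ⟨
      evalMonic (c ∷ cs) y                                          ≈⟨ root-y ⟩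
      0#                                                            ∎)

  Poly< : ℕ → (Carrier → Carrier) → Set (c Level.⊔ ℓ)
  Poly< d f = ∃ λ (cs : Vec Carrier d) → ∀ x → eval cs x ≈ f x

  poly<-0# : ∀ d → Poly< d (λ _ → 0#)
  poly<-0# d = replicate d 0# , eval-zeros d
    where
    eval-zeros : ∀ d x → eval (replicate d 0#) x ≈ 0#
    eval-zeros zero    x = refl
    eval-zeros (suc d) x = trans (+-identityˡ _) (trans (*-congˡ (eval-zeros d x)) (zeroʳ x))

  poly<-+ : ∀ {d f g} → Poly< d f → Poly< d g → Poly< d (λ x → f x + g x)
  poly<-+ (cs , cs≈f) (ds , ds≈g) = zipWith _+_ cs ds , λ x → trans (eval-+ cs ds x) (+-cong (cs≈f x) (ds≈g x))
    where
    eval-+ : ∀ {d} (cs ds : Vec Carrier d) x → eval (zipWith _+_ cs ds) x ≈ eval cs x + eval ds x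
    eval-+ []       []       x = sym (+-identityˡ 0#)
    eval-+ (c ∷ cs) (d ∷ ds) x = begin
      (c + d) + x * eval (zipWith _+_ cs ds) x    ≈⟨ +-congˡ (*-congˡ (eval-+ cs ds x)) ⟩
      (c + d) + x * (eval cs x + eval ds x)       ≈⟨ +-congˡ (distribˡ x _ _) ⟩
      (c + d) + (x * eval cs x + x * eval ds x)   ≈⟨ interchange c d _ _ ⟩
      (c + x * eval cs x) + (d + x * eval ds x)   ∎

  poly<-neg : ∀ {d f} → Poly< d f → Poly< d (λ x → - f x)
  poly<-neg (cs , cs≈f) = Vec.map -_ cs , λ x → trans (eval-neg cs x) (-‿cong (cs≈f x))
    where
    eval-neg : ∀ {d} (cs : Vec Carrier d) x → eval (Vec.map -_ cs) x ≈ - eval cs x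
    eval-neg []       x = sym ε⁻¹≈ε
    eval-neg (c ∷ cs) x = begin
      - c + x * eval (Vec.map -_ cs) x    ≈⟨ +-congˡ (*-congˡ (eval-neg cs x)) ⟩
      - c + x * - eval cs x                    ≈⟨ +-congˡ (-‿distribʳ-* x _) ⟨
      - c + - (x * eval cs x)                  ≈⟨ ⁻¹-∙-comm c _ ⟩
      - (c + x * eval cs x)                    ∎

  poly<-pow : ∀ {d j} → j < d → Poly< d (λ x → pow R x j)
  poly<-pow {suc d} {zero} _ with poly<-0# d
  ... | zeros , zeros≈0 = 1# ∷ zeros , λ x → trans (+-congˡ (trans (*-congˡ (zeros≈0 x)) (zeroʳ x))) (+-identityʳ 1#)
  poly<-pow {suc d} {suc j} (ℕ.s≤s j<d) with poly<-pow j<d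
  ... | cs , cs≈xʲ = 0# ∷ cs , λ x → trans (+-identityˡ _) (*-congˡ (cs≈xʲ x))

  poly<-∑ : ∀ {a} {A : Set a} {d} xs (g : A → Carrier → Carrier) → (∀ {i} → i ∈ xs → Poly< d (g i)) →
            Poly< d (λ x → ∑ xs (λ i → g i x))
  poly<-∑ {d = d} []       g poly = poly<-0# d
  poly<-∑         (i ∷ xs) g poly = poly<-+ (poly (here ≡.refl)) (poly<-∑ xs g (poly ∘ there))

  monic-roots-bound : ∀ {d f} → Poly< d f → ∀ {xs} → Unique xs → All (λ x → f x + pow R x d ≈ 0#) xs →
                      length xs ≤ d
  monic-roots-bound (cs , cs≈f) unique roots =
    roots-bound cs unique (All.map (λ {x} root → trans (evalMonic≈eval+pow cs x) (trans (+-congʳ (cs≈f x)) root)) roots)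

module Frobenius {c ℓ} (R : CommutativeRing c ℓ) where
  open CommutativeRing R
  open RingLemmas R
  open import Relation.Binary.Reasoning.Setoid setoid
  open import Algebra.Properties.Semiring.Exp semiring using () renaming (_^_ to _^ᴿ_)
  open import Algebra.Properties.Semiring.Mult semiring using (×-assoc-*; ×-congʳ) renaming (_×_ to _·_)
  open import Algebra.Properties.Monoid.Sum +-monoid using (sum)
  open import Algebra.Properties.CommutativeSemiring.Binomial commutativeSemiring using (theorem; binomial; binomialTerm)

  ·≈ofℕ* : ∀ n z → n · z ≈ ofℕ R n * z
  ·≈ofℕ* n z = begin
    n · z          ≈⟨ ×-congʳ n (*-identityˡ z) ⟨
    n · (1# * z)   ≈⟨ ×-assoc-* n 1# z ⟨
    (n · 1#) * z   ≡⟨ ≡.cong (_* z) (ofℕ≡·1# n) ⟨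
    ofℕ R n * z    ∎

  sum≈last : ∀ n (t : Vector Carrier (suc n)) → (∀ i → toℕ i < n → t i ≈ 0#) → sum t ≈ t (fromℕ n)
  sum≈last zero    t _       = +-identityʳ _
  sum≈last (suc n) t t<n≈0 =
    trans (+-cong (t<n≈0 Fin.zero (ℕ.s≤s ℕ.z≤n))
                  (sum≈last n (t ∘ Fin.suc) (λ i i<n → t<n≈0 (Fin.suc i) (ℕ.s≤s i<n))))
          (+-identityˡ _)

  pow-+-prime : ∀ {p} → Prime p → ofℕ R p ≈ 0# → ∀ x y → pow R (x + y) p ≈ pow R x p + pow R y p
  pow-+-prime {suc n} prime-p p·1≈0 x y = begin
    pow R (x + y) (suc n)                     ≡⟨ pow≡^ (x + y) (suc n) ⟩
    (x + y) ^ᴿ suc n                           ≈⟨ theorem (suc n) x y ⟩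
    t Fin.zero + sum (t ∘ Fin.suc)            ≈⟨ +-cong first≈yⁿ (sum≈last n (t ∘ Fin.suc) middle≈0) ⟩
    y ^ᴿ suc n + t (fromℕ (suc n))             ≈⟨ +-comm _ _ ⟩
    t (fromℕ (suc n)) + y ^ᴿ suc n             ≈⟨ +-congʳ last≈xⁿ ⟩
    x ^ᴿ suc n + y ^ᴿ suc n                     ≡⟨ ≡.cong₂ _+_ (pow≡^ x (suc n)) (pow≡^ y (suc n)) ⟨
    pow R x (suc n) + pow R y (suc n)         ∎
    where
    t : Vector Carrier (suc (suc n))
    t = binomialTerm x y (suc n)
    first≈yⁿ : t Fin.zero ≈ y ^ᴿ suc n
    first≈yⁿ = trans (+-identityʳ _) (*-identityˡ _)
    middle≈0 : ∀ i → toℕ i < n → t (Fin.suc i) ≈ 0#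
    middle≈0 i i<n with prime∣pCk prime-p (ℕ.s≤s ℕ.z≤n) (ℕ.s≤s i<n)
    ... | divides q eq = begin
      t (Fin.suc i)                     ≈⟨ ·≈ofℕ* (suc n C suc (toℕ i)) b ⟩
      ofℕ R (suc n C suc (toℕ i)) * b   ≡⟨ ≡.cong (λ m → ofℕ R m * b) eq ⟩
      ofℕ R (q ℕ.* suc n) * b           ≈⟨ *-congʳ (trans (ofℕ-* q (suc n)) (trans (*-congˡ p·1≈0) (zeroʳ _))) ⟩
      0# * b                            ≈⟨ zeroˡ b ⟩
      0#                                ∎
      where
      b : Carrier
      b = binomial x y (suc n) (Fin.suc i)
    last≈xⁿ : t (fromℕ (suc n)) ≈ x ^ᴿ suc n
    last≈xⁿ rewrite toℕ-fromℕ n | nCn≡1 (suc n) | ℕ.n∸n≡0 n =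
      trans (+-identityʳ _) (*-identityʳ _)

module PrimeCharacteristic {c ℓ} (R : CommutativeRing c ℓ) (isField : IsFieldCR R)
  {p} (prime-p : Prime p) (p·1≈0 : CommutativeRing._≈_ R (ofℕ R p) (CommutativeRing.0# R)) where
  open CommutativeRing R
  open IsFieldCR isField using (1≉0)
  open RingLemmas R
  open Polynomials R isField using (poly<-neg; poly<-pow; monic-roots-bound)
  open import Relation.Binary.Reasoning.Setoid setoid
  open import Data.List.Relation.Unary.Unique.Setoid setoid using (Unique)

  instance
    p≢0 : NonZero p
    p≢0 = prime⇒nonZero prime-p

  1<p : 1 < p
  1<p = ℕ.nonTrivial⇒n>1 p {{prime⇒nonTrivial prime-p}}

  private
    module ofℕ-Hom = NatHomomorphism +-monoid (ofℕ R) refl ofℕ-+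

  ofℕ-% : ∀ m → ofℕ R (m % p) ≈ ofℕ R m
  ofℕ-% = ofℕ-Hom.h-% p·1≈0

  ofℕ-injective : ∀ {m n} → m < p → n < p → ofℕ R m ≈ ofℕ R n → m ≡ n
  ofℕ-injective = ofℕ-Hom.h-injective prime-p p·1≈0 (1≉0 ∘ trans (sym (+-identityʳ 1#)))
                    (λ m → +-cancelˡ (ofℕ R m) _ _)

  frobenius-+ : ∀ x y → pow R (x + y) p ≈ pow R x p + pow R y p
  frobenius-+ = Frobenius.pow-+-prime R prime-p p·1≈0

  frobenius-∑ : ∀ {a} {A : Set a} xs (f : A → Carrier) → pow R (∑ xs f) p ≈ ∑ xs (λ i → pow R (f i) p)
  frobenius-∑ []       f = pow-0# p
  frobenius-∑ (x ∷ xs) f = trans (frobenius-+ (f x) (∑ xs f)) (+-congˡ (frobenius-∑ xs f))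

  frobenius^-+ : ∀ i x y → pow R (x + y) (p ℕ.^ i) ≈ pow R x (p ℕ.^ i) + pow R y (p ℕ.^ i)
  frobenius^-+ zero    x y = trans (*-identityʳ _) (sym (+-cong (*-identityʳ x) (*-identityʳ y)))
  frobenius^-+ (suc i) x y = begin
    pow R (x + y) (p ℕ.* q)                       ≈⟨ pow-* (x + y) p q ⟩
    pow R (pow R (x + y) p) q                     ≈⟨ pow-cong q (frobenius-+ x y) ⟩
    pow R (pow R x p + pow R y p) q               ≈⟨ frobenius^-+ i _ _ ⟩
    pow R (pow R x p) q + pow R (pow R y p) q     ≈⟨ +-cong (pow-* x p q) (pow-* y p q) ⟨
    pow R x (p ℕ.* q) + pow R y (p ℕ.* q)         ∎
    where
    q : ℕ
    q = p ℕ.^ i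

  fermat : ∀ n → pow R (ofℕ R n) p ≈ ofℕ R n
  fermat zero    = pow-0# p
  fermat (suc n) = trans (frobenius-+ 1# (ofℕ R n)) (+-cong (pow-1# p) (fermat n))

  module _ (_≟_ : ∀ x y → Dec (x ≈ y)) where

    pow-p≈id⇒ofℕ : ∀ {y} → pow R y p ≈ y → ∃ λ n → n < p × ofℕ R n ≈ y
    pow-p≈id⇒ofℕ {y} yᵖ≈y with any? (_≟ y) (applyUpTo (ofℕ R) p)
    ... | yes y∈ = Anyₚ.applyUpTo⁻ (ofℕ R) y∈
    ... | no  y∉ = ⊥-elim (ℕ.n≮n p (≡.subst (_≤ p) (≡.cong suc (length-applyUpTo (ofℕ R) p))
                     (monic-roots-bound (poly<-neg (poly<-pow 1<p)) unique roots)))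
      where
      fixed⇒root : ∀ {z} → pow R z p ≈ z → - pow R z 1 + pow R z p ≈ 0#
      fixed⇒root {z} zᵖ≈z = trans (+-cong (-‿cong (*-identityʳ z)) zᵖ≈z) (-‿inverseˡ z)
      unique : Unique (y ∷ applyUpTo (ofℕ R) p)
      unique = All.map (λ n≉y y≈n → n≉y (sym y≈n)) (¬Any⇒All¬ _ y∉)
             ∷ AllPairsₚ.applyUpTo⁺₁ (ofℕ R) p
                 (λ i<j j<p → ℕ.<⇒≢ i<j ∘ ofℕ-injective (ℕ.<-trans i<j j<p) j<p)
      roots : All (λ z → - pow R z 1 + pow R z p ≈ 0#) (y ∷ applyUpTo (ofℕ R) p)
      roots = fixed⇒root yᵖ≈y ∷ Allₚ.applyUpTo⁺₂ (ofℕ R) p (λ n → fixed⇒root (fermat n))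

module RootsOfUnity {c ℓ} (K : CommutativeRing c ℓ) (isField : IsFieldCR K) {n} (prime-n : Prime n)
  {z} (zⁿ≈1 : CommutativeRing._≈_ K (pow K z n) (CommutativeRing.1# K))
  (z≉1 : ¬ CommutativeRing._≈_ K z (CommutativeRing.1# K)) where
  open CommutativeRing K
  open IsFieldCR isField using (1≉0)
  open RingLemmas K
  open FieldLemmas K isField

  instance
    n≢0 : NonZero n
    n≢0 = prime⇒nonZero prime-n

  z≉0 : ¬ z ≈ 0#
  z≉0 z≈0 = 1≉0 (trans (sym zⁿ≈1) (trans (pow-cong n z≈0) (pow-0# n)))

  private
    module pow-Hom = NatHomomorphism *-monoid (pow K z) refl (pow-+ z)

  pow-% : ∀ m → pow K z (m % n) ≈ pow K z m
  pow-% = pow-Hom.h-% zⁿ≈1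

  pow-injective : ∀ {a b} → a < n → b < n → pow K z a ≈ pow K z b → a ≡ b
  pow-injective = pow-Hom.h-injective prime-n zⁿ≈1 (z≉1 ∘ trans (sym (*-identityʳ z)))
                    (λ m → *-cancelˡ (pow-≉0 m z≉0))

  pow≉1 : ∀ {k} → 0 < k → k < n → ¬ pow K z k ≈ 1#
  pow≉1 {suc k} _ k<n zᵏ≈1 with pow-injective k<n (ℕ.≤-<-trans ℕ.z≤n k<n) zᵏ≈1
  ... | ()

  pow-pow≈1 : ∀ k → pow K (pow K z k) n ≈ 1#
  pow-pow≈1 k = begin
    pow K (pow K z k) n   ≈⟨ pow-* z k n ⟨
    pow K z (k ℕ.* n)     ≡⟨ ≡.cong (pow K z) (ℕ.*-comm k n) ⟩
    pow K z (n ℕ.* k)     ≈⟨ pow-* z n k ⟩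
    pow K (pow K z n) k   ≈⟨ pow-cong k zⁿ≈1 ⟩
    pow K 1# k            ≈⟨ pow-1# k ⟩
    1#                    ∎
    where open import Relation.Binary.Reasoning.Setoid setoid

module _ {c ℓ} (K : CommutativeRing c ℓ) (isField : IsFieldCR K) {n} (prime-n : Prime n)
  {z} (zⁿ≈1 : CommutativeRing._≈_ K (pow K z n) (CommutativeRing.1# K))
  (z≉1 : ¬ CommutativeRing._≈_ K z (CommutativeRing.1# K)) where
  open CommutativeRing K
  open RingLemmas K using (pow-*)
  open RootsOfUnity K isField prime-n zⁿ≈1 z≉1 using (pow≉1; pow-pow≈1)

  -- z ^ k is again a primitive n-th root of unity.
  pow-*-injective : ∀ {k a b} → 0 < k → k < n → a < n → b < n →
                    pow K z (k ℕ.* a) ≈ pow K z (k ℕ.* b) → a ≡ b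
  pow-*-injective {k} {a} {b} 0<k k<n a<n b<n zᵏᵃ≈zᵏᵇ =
    RootsOfUnity.pow-injective K isField prime-n (pow-pow≈1 k) (pow≉1 0<k k<n) a<n b<n
      (trans (sym (pow-* z k a)) (trans zᵏᵃ≈zᵏᵇ (pow-* z k b)))

module FiniteFieldSums {p r c₁ ℓ₁} (F : FiniteField p r c₁ ℓ₁) where
  open FiniteField F
  open CommutativeRing cring
  open IsFieldCR isField
  open import Algebra.Properties.AbelianGroup +-abelianGroup using (//-rightDividesˡ; //-rightDividesʳ)

  decSetoid : DecSetoid c₁ ℓ₁
  decSetoid = record { isDecEquivalence = record { isEquivalence = isEquivalence ; _≟_ = _≟_ } }

  module _ {c ℓ} (M : CommutativeMonoid c ℓ) where
    open CommutativeMonoid M using () renaming (_≈_ to _≈ᴹ_)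
    open ListSum M using () renaming (∑ to ∑ᴹ)
    open KroneckerSum M decSetoid using (∑-reindex)

    ∑-translate : ∀ d {h} → h Preserves _≈_ ⟶ _≈ᴹ_ → ∑ᴹ elems (λ a → h (a + d)) ≈ᴹ ∑ᴹ elems h
    ∑-translate d = ∑-reindex distinct complete
      ( (λ y≈x-d → trans (+-congʳ y≈x-d) (//-rightDividesˡ d _))
      , (λ y≈x+d → trans (+-congʳ y≈x+d) (//-rightDividesʳ d _)) )

    ∑-dilate : ∀ {u} → ¬ u ≈ 0# → ∀ {h} → h Preserves _≈_ ⟶ _≈ᴹ_ →
               ∑ᴹ elems (λ a → h (u * a)) ≈ᴹ ∑ᴹ elems h
    ∑-dilate {u} u≉0 with inverse u u≉0
    ... | u⁻¹ , uu⁻¹≈1 = ∑-reindex distinct complete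
      ( (λ {x} y≈u⁻¹x → trans (*-congˡ y≈u⁻¹x) (cancel u u⁻¹ x uu⁻¹≈1))
      , (λ {x} y≈ux → trans (*-congˡ y≈ux) (cancel u⁻¹ u x (trans (*-comm u⁻¹ u) uu⁻¹≈1))) )
      where
      cancel : ∀ v w x → v * w ≈ 1# → v * (w * x) ≈ x
      cancel v w x vw≈1 = trans (sym (*-assoc v w x)) (trans (*-congʳ vw≈1) (*-identityˡ x))

module FiniteFieldProperties {p r c₁ ℓ₁} (F : FiniteField p r c₁ ℓ₁) (prime-p : Prime p) where
  open FiniteField F
  open CommutativeRing cring
  open IsFieldCR isField
  open RingLemmas cring
  open FieldLemmas cring isField
  open Polynomials cring isField using (Poly<; poly<-∑; poly<-pow; monic-roots-bound)
  open FiniteFieldSums F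
  open import Relation.Binary.Reasoning.Setoid setoid

  card·1≈0 : ofℕ cring (p ℕ.^ r) ≈ 0#
  card·1≈0 = +-identityʳ-unique (∑ elems id) (ofℕ cring (p ℕ.^ r)) (begin
    ∑ elems id + ofℕ cring (p ℕ.^ r)       ≡⟨ ≡.cong (λ n → ∑ elems id + ofℕ cring n) card ⟨
    ∑ elems id + ofℕ cring (length elems)  ≈⟨ +-congˡ (∑-1# elems) ⟨
    ∑ elems id + ∑ elems (λ _ → 1#)        ≈⟨ ∑-distrib-∙ elems id (λ _ → 1#) ⟨
    ∑ elems (λ a → a + 1#)                 ≈⟨ ∑-translate +-commutativeMonoid 1# id ⟩
    ∑ elems id                             ∎)

  p·1≈0 : ofℕ cring p ≈ 0#
  p·1≈0 with ofℕ cring p ≟ 0#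
  ... | yes p·1≈0 = p·1≈0
  ... | no  p·1≉0 = ⊥-elim (pow-≉0 r p·1≉0 (trans (sym (ofℕ-^ p r)) card·1≈0))

  open PrimeCharacteristic cring isField prime-p p·1≈0 public

  -- a ↦ x * a permutes F; compare the products of all elements, with 0 replaced by 1.
  pow-card≈id : ∀ x → pow cring x (p ℕ.^ r) ≈ x
  pow-card≈id x with x ≟ 0#
  ... | yes x≈0 = trans (pow-cong (p ℕ.^ r) x≈0) (trans (pow-0# (p ℕ.^ r) {{ℕ.m^n≢0 p r}}) (sym x≈0))
  ... | no  x≉0 = *-cancelʳ (∏-≉0 elems unit≉0) (begin
    pow cring x (p ℕ.^ r) * ∏ elems unit     ≡⟨ ≡.cong (λ n → pow cring x n * ∏ elems unit) card ⟨
    pow cring x (length elems) * ∏ elems unit ≈⟨ ∏-*ˡ elems x unit ⟨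
    ∏ elems (λ a → x * unit a)               ≈⟨ ∏-cong elems x*unit≈g[x*] ⟩
    ∏ elems (λ a → g (x * a))                ≈⟨ ∑-dilate *-commutativeMonoid x≉0 g-cong ⟩
    ∏ elems g                                ≈⟨ ∏-distrib-* elems (λ b → δ b 0# x) unit ⟩
    ∏ elems (λ b → δ b 0# x) * ∏ elems unit  ≈⟨ *-congʳ (∑-δ x distinct (complete 0#)) ⟩
    x * ∏ elems unit                         ∎)
    where
    open KroneckerSum *-commutativeMonoid decSetoid using (δ; ∑-δ)
    unit : Carrier → Carrier
    unit a = if does (a ≟ 0#) then 1# else a
    unit≉0 : ∀ a → ¬ unit a ≈ 0#
    unit≉0 a with a ≟ 0#
    ... | yes _   = 1≉0
    ... | no  a≉0 = a≉0
    g : Carrier → Carrier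
    g b = δ b 0# x * unit b
    g-cong : g Preserves _≈_ ⟶ _≈_
    g-cong {a} {b} a≈b with a ≟ 0# | b ≟ 0#
    ... | yes _   | yes _   = refl
    ... | no  _   | no  _   = *-congˡ a≈b
    ... | yes a≈0 | no  b≉0 = ⊥-elim (b≉0 (trans (sym a≈b) a≈0))
    ... | no  a≉0 | yes b≈0 = ⊥-elim (a≉0 (trans a≈b b≈0))
    x*unit≈g[x*] : ∀ a → x * unit a ≈ g (x * a)
    x*unit≈g[x*] a with a ≟ 0# | (x * a) ≟ 0#
    ... | yes _   | yes _    = refl
    ... | no  _   | no  _    = sym (*-identityˡ _)
    ... | yes a≈0 | no  xa≉0 = ⊥-elim (xa≉0 (trans (*-congˡ a≈0) (zeroʳ x)))
    ... | no  a≉0 | yes xa≈0 = ⊥-elim (*-≉0 x≉0 a≉0 xa≈0)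

  trace-term : Carrier → ℕ → Carrier
  trace-term x i = pow cring x (p ℕ.^ i)

  tr≡∑ : ∀ x → tr x ≡ ∑ (upTo r) (trace-term x)
  tr≡∑ x = sumR-map (trace-term x) (upTo r)

  tr-cong : ∀ {x y} → x ≈ y → tr x ≈ tr y
  tr-cong {x} {y} x≈y = begin
    tr x                        ≡⟨ tr≡∑ x ⟩
    ∑ (upTo r) (trace-term x)   ≈⟨ ∑-cong (upTo r) (λ i → pow-cong (p ℕ.^ i) x≈y) ⟩
    ∑ (upTo r) (trace-term y)   ≡⟨ tr≡∑ y ⟨
    tr y                        ∎

  tr-+ : ∀ x y → tr (x + y) ≈ tr x + tr y
  tr-+ x y = begin
    tr (x + y)                                                ≡⟨ tr≡∑ (x + y) ⟩
    ∑ (upTo r) (trace-term (x + y))                           ≈⟨ ∑-cong (upTo r) (λ i → frobenius^-+ i x y) ⟩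
    ∑ (upTo r) (λ i → trace-term x i + trace-term y i)        ≈⟨ ∑-distrib-∙ (upTo r) _ _ ⟩
    ∑ (upTo r) (trace-term x) + ∑ (upTo r) (trace-term y)     ≡⟨ ≡.cong₂ _+_ (tr≡∑ x) (tr≡∑ y) ⟨
    tr x + tr y                                               ∎

  tr-0# : tr 0# ≈ 0#
  tr-0# = +-identityʳ-unique (tr 0#) (tr 0#) (trans (sym (tr-+ 0# 0#)) (tr-cong (+-identityʳ 0#)))

  -- Frobenius shifts the terms x^(p^i) cyclically, since x^(p^r) = x.
  pow-tr≈tr : ∀ x → pow cring (tr x) p ≈ tr x
  pow-tr≈tr x = begin
    pow cring (tr x) p                                  ≡⟨ ≡.cong (λ t → pow cring t p) (tr≡∑ x) ⟩
    pow cring (∑ (upTo r) (trace-term x)) p             ≈⟨ frobenius-∑ (upTo r) (trace-term x) ⟩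
    ∑ (upTo r) (λ i → pow cring (trace-term x i) p)     ≈⟨ ∑-cong (upTo r) (λ i → pow-p^i-p i) ⟩
    ∑ (upTo r) (trace-term x ∘ suc)                     ≈⟨ ∑-upTo-rotate r (trace-term x) last≈first ⟩
    ∑ (upTo r) (trace-term x)                           ≡⟨ tr≡∑ x ⟨
    tr x                                                ∎
    where
    pow-p^i-p : ∀ i → pow cring (trace-term x i) p ≈ trace-term x (suc i)
    pow-p^i-p i = trans (sym (pow-* x (p ℕ.^ i) p)) (reflexive (≡.cong (pow cring x) (ℕ.*-comm (p ℕ.^ i) p)))
    last≈first : trace-term x r ≈ trace-term x 0
    last≈first = trans (pow-card≈id x) (sym (*-identityʳ x))

  tr∈𝔽ₚ : ∀ x → ∃ λ n → n < p × ofℕ cring n ≈ tr x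
  tr∈𝔽ₚ x = pow-p≈id⇒ofℕ _≟_ (pow-tr≈tr x)

  tr≉0 : 1 ≤ r → ∃ λ b → ¬ tr b ≈ 0#
  tr≉0 1≤r with all? (λ b → tr b ≟ 0#) elems
  ... | no  ¬all = satisfied (¬All⇒Any¬ (λ b → tr b ≟ 0#) elems ¬all)
  ... | yes all  = ⊥-elim (ℕ.<⇒≱ d<q (monic-roots-bound lower distinct (All.map root all)))
    where
    r′ d : ℕ
    r′ = ℕ.pred r
    d  = p ℕ.^ r′
    r≡1+r′ : r ≡ suc r′
    r≡1+r′ = ≡.sym (ℕ.suc-pred r {{ℕ.>-nonZero 1≤r}})
    d<q : d < length elems
    d<q = ≡.subst (d <_) (≡.trans (≡.cong (p ℕ.^_) (≡.sym r≡1+r′)) (≡.sym card)) (ℕ.^-monoʳ-< p 1<p (ℕ.n<1+n r′))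
    lower : Poly< d (λ x → ∑ (upTo r′) (trace-term x))
    lower = poly<-∑ (upTo r′) (λ i x → trace-term x i) (λ i∈ → poly<-pow (ℕ.^-monoʳ-< p 1<p (∈-upTo⁻ i∈)))
    root : ∀ {x} → tr x ≈ 0# → ∑ (upTo r′) (trace-term x) + pow cring x d ≈ 0#
    root {x} trx≈0 = begin
      ∑ (upTo r′) (trace-term x) + trace-term x r′  ≈⟨ ∑-∷ʳ (upTo r′) r′ (trace-term x) ⟨
      ∑ (upTo r′ ∷ʳ r′) (trace-term x)              ≡⟨ ≡.cong (λ xs → ∑ xs (trace-term x)) (upTo-∷ʳ r′) ⟩
      ∑ (upTo (suc r′)) (trace-term x)              ≡⟨ ≡.cong (λ n → ∑ (upTo n) (trace-term x)) r≡1+r′ ⟨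
      ∑ (upTo r) (trace-term x)                     ≡⟨ tr≡∑ x ⟨
      tr x                                          ≈⟨ trx≈0 ⟩
      0#                                            ∎

module AdditiveCharacters {p r c₁ ℓ₁ c₂ ℓ₂} (F : FiniteField p r c₁ ℓ₁) (K : CommutativeRing c₂ ℓ₂)
                          (isFieldK : IsFieldCR K) where
  private
    module F where
      open FiniteField F public
      open CommutativeRing cring public
      open IsFieldCR isField public using (inverse)
      open RingLemmas cring public using (x≈y⇒x∙y⁻¹≈ε; x∙y⁻¹≈ε⇒x≈y)
      open FiniteFieldSums F public
    module K where
      open CommutativeRing K public
      open RingLemmas K public
      open FieldLemmas K isFieldK public
  open F using (elems)
  open K using (∑; ∑-cong)
  open import Relation.Binary.Reasoning.Setoid K.setoid

  record IsNontrivialAdditiveCharacter (χ : F.Carrier → K.Carrier)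
         : Set (c₁ Level.⊔ ℓ₁ Level.⊔ c₂ Level.⊔ ℓ₂) where
    field
      cong       : χ Preserves F._≈_ ⟶ K._≈_
      homo       : ∀ x y → χ (x F.+ y) K.≈ χ x K.* χ y
      ε-homo     : χ F.0# K.≈ K.1#
      nontrivial : ∃ λ b → ¬ χ b K.≈ K.1#

    ∑χ[a*x]≈0 : ∀ {x} → ¬ x F.≈ F.0# → ∑ elems (λ a → χ (a F.* x)) K.≈ K.0#
    ∑χ[a*x]≈0 {x} x≉0 with nontrivial | F.inverse x x≉0
    -- Translating a by b / x multiplies the sum by χ b ≉ 1.
    ... | b , χb≉1 | x⁻¹ , xx⁻¹≈1 = K.x*y≈x⇒x≈0 χb≉1 (begin
      S K.* χ b                                   ≈⟨ K.∑-*ʳ elems (χ b) (λ a → χ (a F.* x)) ⟨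
      ∑ elems (λ a → χ (a F.* x) K.* χ b)         ≈⟨ ∑-cong elems (λ a → homo (a F.* x) b) ⟨
      ∑ elems (λ a → χ (a F.* x F.+ b))           ≈⟨ ∑-cong elems (λ a → cong (shift a)) ⟨
      ∑ elems (λ a → χ ((a F.+ d) F.* x))         ≈⟨ F.∑-translate K.+-commutativeMonoid d (cong ∘ F.*-congʳ) ⟩
      S                                           ∎)
      where
      S : K.Carrier
      S = ∑ elems (λ a → χ (a F.* x))
      d : F.Carrier
      d = b F.* x⁻¹
      shift : ∀ a → (a F.+ d) F.* x F.≈ a F.* x F.+ b
      shift a = F.trans (F.distribʳ x a d) (F.+-congˡ (F.trans (F.*-assoc b x⁻¹ x)
                  (F.trans (F.*-congˡ (F.trans (F.*-comm x⁻¹ x) xx⁻¹≈1)) (F.*-identityʳ b))))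

    ∑χ[a*x]≈q : ∀ {x} → x F.≈ F.0# → ∑ elems (λ a → χ (a F.* x)) K.≈ ofℕ K (p ℕ.^ r)
    ∑χ[a*x]≈q {x} x≈0 = begin
      ∑ elems (λ a → χ (a F.* x))   ≈⟨ ∑-cong elems (λ a → K.trans (cong (ax≈0 a)) ε-homo) ⟩
      ∑ elems (λ _ → K.1#)          ≈⟨ K.∑-1# elems ⟩
      ofℕ K (length elems)          ≡⟨ ≡.cong (ofℕ K) F.card ⟩
      ofℕ K (p ℕ.^ r)               ∎
      where
      ax≈0 : ∀ a → a F.* x F.≈ F.0#
      ax≈0 a = F.trans (F.*-congˡ x≈0) (F.zeroʳ a)

    fourier-inversion : ∀ {g} → g Preserves F._≈_ ⟶ K._≈_ → ∀ t →
      ∑ elems (λ a → χ (a F.* F.- t) K.* ∑ elems (λ s → χ (a F.* s) K.* g s)) K.≈ ofℕ K (p ℕ.^ r) K.* g t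
    fourier-inversion {g} g-cong t = begin
      ∑ elems (λ a → χ (a F.* F.- t) K.* ∑ elems (λ s → χ (a F.* s) K.* g s))
        ≈⟨ ∑-cong elems (λ a → K.∑-*ˡ elems _ _) ⟨
      ∑ elems (λ a → ∑ elems (λ s → χ (a F.* F.- t) K.* (χ (a F.* s) K.* g s)))
        ≈⟨ K.∑-comm elems elems _ ⟩
      ∑ elems (λ s → ∑ elems (λ a → χ (a F.* F.- t) K.* (χ (a F.* s) K.* g s)))
        ≈⟨ ∑-cong elems (λ s → K.trans (∑-cong elems (merge s)) (K.∑-*ʳ elems (g s) _)) ⟩
      ∑ elems (λ s → ∑ elems (λ a → χ (a F.* (s F.- t))) K.* g s)
        ≈⟨ ∑-cong elems select ⟩
      ∑ elems (λ s → δ s t (ofℕ K (p ℕ.^ r) K.* g t))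
        ≈⟨ ∑-δ _ F.distinct (F.complete t) ⟩
      ofℕ K (p ℕ.^ r) K.* g t
        ∎
      where
      open KroneckerSum K.+-commutativeMonoid F.decSetoid using (δ; ∑-δ)
      merge : ∀ s a → χ (a F.* F.- t) K.* (χ (a F.* s) K.* g s) K.≈ χ (a F.* (s F.- t)) K.* g s
      merge s a = K.trans (K.sym (K.*-assoc _ _ _)) (K.*-congʳ (K.trans (K.sym (homo _ _))
                    (cong (F.trans (F.+-comm _ _) (F.sym (F.distribˡ a s (F.- t)))))))
      select : ∀ s → ∑ elems (λ a → χ (a F.* (s F.- t))) K.* g s K.≈ δ s t (ofℕ K (p ℕ.^ r) K.* g t)
      select s with s F.≟ t
      ... | yes s≈t = K.*-cong (∑χ[a*x]≈q (F.x≈y⇒x∙y⁻¹≈ε s≈t)) (g-cong s≈t)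
      ... | no  s≉t = K.trans (K.*-congʳ (∑χ[a*x]≈0 (s≉t ∘ F.x∙y⁻¹≈ε⇒x≈y s t))) (K.zeroˡ _)

module TraceCharacter {p r ℓ c₁ ℓ₁ c₂ ℓ₂} (F : FiniteField p r c₁ ℓ₁) (K : CyclotomicField p ℓ c₂ ℓ₂)
                      (prime-p : Prime p) (1≤r : 1 ≤ r) where
  private
    module F where
      open FiniteField F public
      open CommutativeRing cring public
      open RingLemmas cring public using (ofℕ-+)
      open FiniteFieldProperties F prime-p public
    module K where
      open CyclotomicField K public
      open CommutativeRing cring public
      open RingLemmas cring public
      open RootsOfUnity cring isField prime-p ζp^p ζp≠1 public
  open import Relation.Binary.Reasoning.Setoid K.setoid
  open AdditiveCharacters F K.cring K.isField using (IsNontrivialAdditiveCharacter)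

  ζ^ : ℕ → K.Carrier
  ζ^ = pow K.cring K.ζp

  -- The summand of ψ is local to its definition; unification against the definition names it.
  ψ-as-sum : ∀ x → ∃ λ (summand : ℕ → K.Carrier) → ψ F K x ≡ sumR K.cring (map summand (upTo p))
  ψ-as-sum x = _ , ≡.refl

  ψ≈ζ^-< : ∀ {x n} → n < p → ofℕ F.cring n F.≈ F.tr x → ψ F K x K.≈ ζ^ n
  ψ≈ζ^-< {x} {n} n<p n≈trx = begin
    ψ F K x                               ≡⟨ proj₂ (ψ-as-sum x) ⟩
    sumR K.cring (map summand (upTo p))   ≡⟨ K.sumR-map summand (upTo p) ⟩
    K.∑ (upTo p) summand                  ≈⟨ K.∑-cong-∈ (upTo p) (summand≈δ ∘ ∈-upTo⁻) ⟩
    K.∑ (upTo p) (λ m → δ m n (ζ^ n))     ≈⟨ ∑-δ (ζ^ n) (upTo⁺ p) (∈-upTo⁺ n<p) ⟩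
    ζ^ n                                  ∎
    where
    open KroneckerSum K.+-commutativeMonoid ℕ.≡-decSetoid using (δ; δ-≃; δ-≄; ∑-δ)
    summand : ℕ → K.Carrier
    summand = proj₁ (ψ-as-sum x)
    summand≈δ : ∀ {m} → m < p → summand m K.≈ δ m n (ζ^ n)
    summand≈δ {m} m<p with ofℕ F.cring m F.≟ F.tr x
    ... | yes m≈trx = K.trans (K.reflexive (≡.cong ζ^ m≡n)) (K.sym (δ-≃ {m} {n} (ζ^ n) m≡n))
      where
      m≡n : m ≡ n
      m≡n = F.ofℕ-injective m<p n<p (F.trans m≈trx (F.sym n≈trx))
    ... | no  m≉trx = K.sym (δ-≄ {m} {n} (ζ^ n) (λ { ≡.refl → m≉trx n≈trx }))

  ψ≈ζ^ : ∀ {x} n → ofℕ F.cring n F.≈ F.tr x → ψ F K x K.≈ ζ^ n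
  ψ≈ζ^ n n≈trx = K.trans (ψ≈ζ^-< (m%n<n n p) (F.trans (F.ofℕ-% n) n≈trx)) (K.pow-% n)

  ψ-isNontrivialAdditiveCharacter : IsNontrivialAdditiveCharacter (ψ F K)
  ψ-isNontrivialAdditiveCharacter = record
    { cong       = ψ-cong
    ; homo       = ψ-+
    ; ε-homo     = ψ≈ζ^ 0 (F.sym F.tr-0#)
    ; nontrivial = ψ≉1
    }
    where
    ψ-cong : ∀ {x y} → x F.≈ y → ψ F K x K.≈ ψ F K y
    ψ-cong {x} {y} x≈y with F.tr∈𝔽ₚ x
    ... | n , _ , n≈trx = K.trans (ψ≈ζ^ n n≈trx) (K.sym (ψ≈ζ^ n (F.trans n≈trx (F.tr-cong x≈y))))
    ψ-+ : ∀ x y → ψ F K (x F.+ y) K.≈ ψ F K x K.* ψ F K y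
    ψ-+ x y with F.tr∈𝔽ₚ x | F.tr∈𝔽ₚ y
    ... | a , _ , a≈trx | b , _ , b≈try = begin
      ψ F K (x F.+ y)          ≈⟨ ψ≈ζ^ (a ℕ.+ b) a+b≈tr[x+y] ⟩
      ζ^ (a ℕ.+ b)             ≈⟨ K.pow-+ K.ζp a b ⟩
      ζ^ a K.* ζ^ b            ≈⟨ K.*-cong (ψ≈ζ^ a a≈trx) (ψ≈ζ^ b b≈try) ⟨
      ψ F K x K.* ψ F K y      ∎
      where
      a+b≈tr[x+y] : ofℕ F.cring (a ℕ.+ b) F.≈ F.tr (x F.+ y)
      a+b≈tr[x+y] = F.trans (F.ofℕ-+ a b) (F.trans (F.+-cong a≈trx b≈try) (F.sym (F.tr-+ x y)))
    ψ≉1 : ∃ λ b → ¬ ψ F K b K.≈ K.1#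
    ψ≉1 with F.tr≉0 1≤r
    ... | b , trb≉0 with F.tr∈𝔽ₚ b
    ...   | n , n<p , n≈trb = b , λ ψb≈1 →
      trb≉0 (F.trans (F.sym n≈trb) (F.reflexive (≡.cong (ofℕ F.cring)
        (K.pow-injective n<p (ℕ.≤-<-trans ℕ.z≤n n<p) (K.trans (K.sym (ψ≈ζ^-< n<p n≈trb)) ψb≈1)))))

module VoltageTransform {p r ℓ c₁ ℓ₁ c₂ ℓ₂}
  (F : FiniteField p r c₁ ℓ₁) (K : CyclotomicField p ℓ c₂ ℓ₂) (k : Fin ℓ) where
  private
    module F where
      open FiniteField F public
      open CommutativeRing cring public
    module K where
      open CyclotomicField K public
      open CommutativeRing cring public
      open RingLemmas cring public
  open import Relation.Binary.Reasoning.Setoid K.setoid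

  weight : (F.Carrier → Fin ℓ) → F.Carrier → K.Carrier
  weight α s = if F.isNzSq s then pow K.cring K.ζℓ (toℕ k ℕ.* toℕ (α s)) else K.0#

  weight-at-square : ∀ α {s} → T (F.isNzSq s) → weight α s K.≈ pow K.cring K.ζℓ (toℕ k ℕ.* toℕ (α s))
  weight-at-square α {s} s∈⊠ with F.isNzSq s
  ... | true = K.refl

  isNzSq-cong : ∀ {s t} → s F.≈ t → F.isNzSq s ≡ F.isNzSq t
  isNzSq-cong {s} {t} s≈t = ≡.cong₂ (λ s≈0 s∈□ → not s≈0 ∧ s∈□)
    (does-⇔ (mk⇔ (F.trans (F.sym s≈t)) (F.trans s≈t)) (s F.≟ F.0#) (t F.≟ F.0#))
    (≡.cong or (map-cong (λ u → does-⇔ (mk⇔ (λ u²≈s → F.trans u²≈s s≈t) (λ u²≈t → F.trans u²≈t (F.sym s≈t)))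
                                       ((u F.* u) F.≟ s) ((u F.* u) F.≟ t))
                         F.elems))

  weight-cong : ∀ {α} → IsVoltage F α → weight α Preserves F._≈_ ⟶ K._≈_
  weight-cong {α} α-voltage {s} {t} s≈t rewrite isNzSq-cong s≈t | IsVoltage.resp α-voltage s≈t = K.refl

  θ≈∑ψ*weight : ∀ α a → θ F K α a k K.≈ K.∑ F.elems (λ s → ψ F K (a F.* s) K.* weight α s)
  θ≈∑ψ*weight α a = begin
    θ F K α a k                                                      ≡⟨ K.sumR-map _ F.squares ⟩
    K.∑ F.squares (λ s → ψ F K (a F.* s) K.* ζᵏᵅ s)                  ≈⟨ K.∑-filter F.isNzSq F.elems _ ⟩
    K.∑ F.elems (λ s → if F.isNzSq s then ψ F K (a F.* s) K.* ζᵏᵅ s else K.0#) ≈⟨ K.∑-cong F.elems pull-out ⟩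
    K.∑ F.elems (λ s → ψ F K (a F.* s) K.* weight α s)               ∎
    where
    ζᵏᵅ : F.Carrier → K.Carrier
    ζᵏᵅ s = pow K.cring K.ζℓ (toℕ k ℕ.* toℕ (α s))
    pull-out : ∀ s → (if F.isNzSq s then ψ F K (a F.* s) K.* ζᵏᵅ s else K.0#) K.≈ ψ F K (a F.* s) K.* weight α s
    pull-out s with F.isNzSq s
    ... | true  = K.refl
    ... | false = K.sym (K.zeroʳ _)

  module _ (prime-p : Prime p) (1≤r : 1 ≤ r) where
    open AdditiveCharacters F K.cring K.isField using (module IsNontrivialAdditiveCharacter)
    open IsNontrivialAdditiveCharacter (TraceCharacter.ψ-isNontrivialAdditiveCharacter F K prime-p 1≤r)
      using (fourier-inversion)
    open FieldLemmas K.cring K.isField using (*-cancelˡ)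

    θ≈θ⇒weight≈weight : ∀ {α β} → IsVoltage F α → IsVoltage F β →
                        (∀ a → θ F K α a k K.≈ θ F K β a k) → ∀ t → weight α t K.≈ weight β t
    θ≈θ⇒weight≈weight {α} {β} α-voltage β-voltage θα≈θβ t = *-cancelˡ q≉0 (begin
      q K.* weight α t
        ≈⟨ fourier-inversion (weight-cong α-voltage) t ⟨
      K.∑ F.elems (λ a → ψ F K (a F.* F.- t) K.* transform α a)
        ≈⟨ K.∑-cong F.elems (λ a → K.*-congˡ (transformα≈transformβ a)) ⟩
      K.∑ F.elems (λ a → ψ F K (a F.* F.- t) K.* transform β a)
        ≈⟨ fourier-inversion (weight-cong β-voltage) t ⟩
      q K.* weight β t
        ∎)
      where
      q : K.Carrier
      q = ofℕ K.cring (p ℕ.^ r)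
      q≉0 : ¬ q K.≈ K.0#
      q≉0 q≈0 = ℕ.<⇒≢ (ℕ.m^n>0 p {{prime⇒nonZero prime-p}} r) (≡.sym (K.char0 _ q≈0))
      transform : (F.Carrier → Fin ℓ) → F.Carrier → K.Carrier
      transform γ a = K.∑ F.elems (λ s → ψ F K (a F.* s) K.* weight γ s)
      transformα≈transformβ : ∀ a → transform α a K.≈ transform β a
      transformα≈transformβ a = K.trans (K.sym (θ≈∑ψ*weight α a)) (K.trans (θα≈θβ a) (θ≈∑ψ*weight β a))

lemma3p1 : {c₁ r₁ c₂ r₂ : Level} (p r ℓ : ℕ) → Prime p → 1 ≤ r → (p ^ r) % 4 ≡ 1 →
    Prime ℓ → ¬ (ℓ ≡ p) →
    (F : FiniteField p r c₁ r₁) (K : CyclotomicField p ℓ c₂ r₂) →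
    (k : Fin ℓ) → ¬ (toℕ k ≡ 0) →
    (α β : CommutativeRing.Carrier (FiniteField.cring F) → Fin ℓ) →
    IsVoltage F α → IsVoltage F β →
    (∀ a → CommutativeRing._≈_ (CyclotomicField.cring K) (θ F K α a k) (θ F K β a k)) →
    ∀ s → T (FiniteField.isNzSq F s) → α s ≡ β s
lemma3p1 p r ℓ prime-p 1≤r _ prime-ℓ _ F K k k≢0 α β α-voltage β-voltage θα≈θβ s s∈⊠ =
  toℕ-injective (pow-*-injective cring isField prime-ℓ ζℓ^ℓ ζℓ≠1
    (ℕ.n≢0⇒n>0 k≢0) (toℕ<n k) (toℕ<n (α s)) (toℕ<n (β s)) ζᵏᵅ≈ζᵏᵝ)
  where
  open CyclotomicField K
  open CommutativeRing cring using (_≈_; setoid)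
  open import Relation.Binary.Reasoning.Setoid setoid
  open VoltageTransform F K k
  ζᵏᵅ≈ζᵏᵝ : pow cring ζℓ (toℕ k ℕ.* toℕ (α s)) ≈ pow cring ζℓ (toℕ k ℕ.* toℕ (β s))
  ζᵏᵅ≈ζᵏᵝ = begin
    pow cring ζℓ (toℕ k ℕ.* toℕ (α s))   ≈⟨ weight-at-square α s∈⊠ ⟨
    weight α s                           ≈⟨ θ≈θ⇒weight≈weight prime-p 1≤r α-voltage β-voltage θα≈θβ s ⟩
    weight β s                           ≈⟨ weight-at-square β s∈⊠ ⟩
    pow cring ζℓ (toℕ k ℕ.* toℕ (β s))   ∎
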